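{- Let $n\geq 2$ be an integer. Then \[ 64(2n+1)\ \Bigm|\ n^2(n+1)\binom{2n}{n}\binom{2n-2}{n-1}\binom{2n+2}{n+1}. \]
   Context: For integers $a\neq 0$ and $b$, $a\mid b$ means that $b/a$ is an integer. -}

module Defs where

module Submission where

-- Write  c(m) = C(2m, m)  for the central binomial coefficients and
-- d(m) = C(2m+1, m).  From the factorial formula C(N, k) k! (N-k)! = N! we
-- derive the absorption identity  (k+1) C(N+1, k+1) = (N+1) C(N, k);
-- together with Pascal's rule and the symmetry  C(N, a) = C(N, b)  for
-- a + b = N  it yields two classical facts:
--
--   * evenness:    c(m+1) = 2 d(m);
--   * recurrence:  (m+1) c(m+1) = 2 (2m+1) c(m).
--
-- For n = m + 1 ≥ 2 the product in the theorem is  n² (n+1) c(n) c(m) c(n+1).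
-- Feeding the recurrence at n and at m and the evenness  c(m) = 2 d(m-1)
-- into a pure ring identity, the product equals  (2n-1)² d(m-1)³ · 64 (2n+1),
-- which exhibits the required quotient explicitly.

open import Defs
open import Data.Nat using (ℕ; suc; _+_; _*_; _∸_; _^_; _≤_)
open import Data.Nat.Divisibility using (_∣_)
open import Data.Nat.Combinatorics using (_C_)

open import Data.Nat.Base using (zero; _!; s≤s)
open import Data.Nat.Properties
  using (_!≢0; _!*_!≢0; *-cancelʳ-≡; m≤m+n; m+n∸m≡n;
         *-distribˡ-∸; +-comm; *-assoc; +-identityʳ)
open import Data.Nat.DivMod using (m/n*n≡m)
open import Data.Nat.Divisibility using (divides)
open import Data.Nat.Combinatorics
  using (nCk≡n!/k![n-k]!; nCk≡nC[n∸k]; nCk+nC[k+1]≡[n+1]C[k+1]; k![n∸k]!∣n!)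
open import Data.Nat.Tactic.RingSolver using (solve-∀)
open import Relation.Binary.PropositionalEquality
open ≡-Reasoning

binomial-factorial : ∀ N k → k ≤ N → (N C k) * (k ! * (N ∸ k) !) ≡ N !
binomial-factorial N k k≤N = begin
  (N C k) * (k ! * (N ∸ k) !)
    ≡⟨ cong (_* (k ! * (N ∸ k) !)) (nCk≡n!/k![n-k]! k≤N) ⟩
  (N ! / (k ! * (N ∸ k) !)) * (k ! * (N ∸ k) !)
    ≡⟨ m/n*n≡m (k![n∸k]!∣n! k≤N) ⟩
  N ! ∎
  where
  open Data.Nat.DivMod using (_/_)
  instance _ = k !* (N ∸ k) !≢0

-- Absorption:  (k+1) C(N+1, k+1) = (N+1) C(N, k).  Both sides, multiplied
-- by the nonzero number k! (N-k)!, equal (N+1)!.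
absorption : ∀ N k → k ≤ N → suc k * (suc N C suc k) ≡ suc N * (N C k)
absorption N k k≤N = *-cancelʳ-≡ _ _ D {{k !* (N ∸ k) !≢0}} (begin
  suc k * (suc N C suc k) * D
    ≡⟨ regroup k (suc N C suc k) (k !) ((N ∸ k) !) ⟩
  (suc N C suc k) * ((suc k) ! * (suc N ∸ suc k) !)
    ≡⟨ binomial-factorial (suc N) (suc k) (s≤s k≤N) ⟩
  suc N * N !
    ≡⟨ cong (suc N *_) (sym (binomial-factorial N k k≤N)) ⟩
  suc N * ((N C k) * D)
    ≡⟨ sym (*-assoc (suc N) (N C k) D) ⟩
  suc N * (N C k) * D ∎)
  where
  D : ℕ
  D = k ! * (N ∸ k) !
  -- (k+1) · k! = (k+1)!, moved next to the (N-k)! factor.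
  regroup : ∀ k X f r → suc k * X * (f * r) ≡ X * ((f + k * f) * r)
  regroup = solve-∀

-- Symmetry of binomial coefficients, phrased without truncated subtraction.
binomial-symmetric : ∀ N a b → a + b ≡ N → N C a ≡ N C b
binomial-symmetric N a b refl =
  trans (nCk≡nC[n∸k] (m≤m+n a b)) (cong ((a + b) C_) (m+n∸m≡n a b))

central : ℕ → ℕ
central m = (2 * m) C m

odd-central : ℕ → ℕ
odd-central m = (2 * m + 1) C m

odd-central-symmetric : ∀ m → (2 * m + 1) C suc m ≡ odd-central m
odd-central-symmetric m =
  binomial-symmetric (2 * m + 1) (suc m) m (indices-sum m)
  where
  indices-sum : ∀ x → suc x + x ≡ 2 * x + 1
  indices-sum = solve-∀

-- Pascal's rule splits c(m+1) into two equal halves.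
central-even : ∀ m → central (suc m) ≡ 2 * odd-central m
central-even m = begin
  (2 * suc m) C suc m
    ≡⟨ cong (_C suc m) (double-suc m) ⟩
  suc (2 * m + 1) C suc m
    ≡⟨ sym (nCk+nC[k+1]≡[n+1]C[k+1] (2 * m + 1) m) ⟩
  odd-central m + (2 * m + 1) C suc m
    ≡⟨ cong (odd-central m +_) (odd-central-symmetric m) ⟩
  odd-central m + odd-central m
    ≡⟨ cong (odd-central m +_) (sym (+-identityʳ (odd-central m))) ⟩
  2 * odd-central m ∎
  where
  double-suc : ∀ x → 2 * suc x ≡ suc (2 * x + 1)
  double-suc = solve-∀

-- Absorption at N = 2m, k = m:  (m+1) C(2m+1, m) = (2m+1) c(m).
odd-central-recurrence : ∀ m → suc m * odd-central m ≡ (2 * m + 1) * central m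
odd-central-recurrence m = begin
  suc m * odd-central m
    ≡⟨ cong (suc m *_) (sym (odd-central-symmetric m)) ⟩
  suc m * ((2 * m + 1) C suc m)
    ≡⟨ cong (λ N → suc m * (N C suc m)) (+-comm (2 * m) 1) ⟩
  suc m * (suc (2 * m) C suc m)
    ≡⟨ absorption (2 * m) m (m≤m+n m (m + 0)) ⟩
  suc (2 * m) * central m
    ≡⟨ cong (_* central m) (+-comm 1 (2 * m)) ⟩
  (2 * m + 1) * central m ∎

central-recurrence : ∀ m → suc m * central (suc m) ≡ 2 * (2 * m + 1) * central m
central-recurrence m = begin
  suc m * central (suc m)
    ≡⟨ cong (suc m *_) (central-even m) ⟩
  suc m * (2 * odd-central m)
    ≡⟨ move-double (suc m) (odd-central m) ⟩
  2 * (suc m * odd-central m)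
    ≡⟨ cong (2 *_) (odd-central-recurrence m) ⟩
  2 * ((2 * m + 1) * central m)
    ≡⟨ sym (*-assoc 2 (2 * m + 1) (central m)) ⟩
  2 * (2 * m + 1) * central m ∎
  where
  move-double : ∀ x y → x * (2 * y) ≡ 2 * (x * y)
  move-double = solve-∀

product-identity : ∀ n t B b E d →
  (n + 1) * E ≡ 2 * (2 * n + 1) * B → n * B ≡ 2 * t * b → b ≡ 2 * d →
  n ^ 2 * (n + 1) * B * b * E ≡ t ^ 2 * d ^ 3 * (64 * (2 * n + 1))
product-identity n t B b E d upper lower refl = begin
  n ^ 2 * (n + 1) * B * (2 * d) * E
    ≡⟨ isolate n B d E ⟩
  (n + 1) * E * (n * B) * (n * (2 * d))
    ≡⟨ cong (λ x → x * (n * B) * (n * (2 * d))) upper ⟩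
  2 * (2 * n + 1) * B * (n * B) * (n * (2 * d))
    ≡⟨ pair n B d ⟩
  2 * (2 * n + 1) * (n * B) * (n * B) * (2 * d)
    ≡⟨ cong (λ x → 2 * (2 * n + 1) * x * x * (2 * d)) lower ⟩
  2 * (2 * n + 1) * (2 * t * (2 * d)) * (2 * t * (2 * d)) * (2 * d)
    ≡⟨ collect n t d ⟩
  t ^ 2 * d ^ 3 * (64 * (2 * n + 1)) ∎
  where
  -- Pure ring rearrangements.  The solver does not reflect _^_, so powers
  -- are written unfolded, e.g.  x ^ 2 = x * (x * 1)  definitionally.
  isolate : ∀ x y z w → x * (x * 1) * (x + 1) * y * (2 * z) * w
                        ≡ (x + 1) * w * (x * y) * (x * (2 * z))
  isolate = solve-∀
  pair : ∀ x y z → 2 * (2 * x + 1) * y * (x * y) * (x * (2 * z))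
                   ≡ 2 * (2 * x + 1) * (x * y) * (x * y) * (2 * z)
  pair = solve-∀
  collect : ∀ x y z → 2 * (2 * x + 1) * (2 * y * (2 * z)) * (2 * y * (2 * z)) * (2 * z)
                      ≡ y * (y * 1) * (z * (z * (z * 1))) * (64 * (2 * x + 1))
  collect = solve-∀

-- The coefficients C(2n+2, n+1) and C(2m, m) as they are indexed in the
-- theorem, where the second appears as C(2(m+1) - 2, m).
shifted-central-upper : ∀ n → (2 * n + 2) C (n + 1) ≡ central (suc n)
shifted-central-upper n = cong₂ _C_ (double-suc n) (+-comm n 1)
  where
  double-suc : ∀ x → 2 * x + 2 ≡ 2 * suc x
  double-suc = solve-∀

shifted-central-lower : ∀ m → (2 * suc m ∸ 2) C m ≡ central m
shifted-central-lower m = cong (_C m) (sym (*-distribˡ-∸ 2 (suc m) 1))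

lemma2p3 : ∀ (n : ℕ) → 2 ≤ n →
    64 * (2 * n + 1) ∣ n ^ 2 * (n + 1) * ((2 * n) C n) * ((2 * n ∸ 2) C (n ∸ 1)) * ((2 * n + 2) C (n + 1))
lemma2p3 (suc zero) (s≤s ())
lemma2p3 (suc (suc k)) _ =
  divides (t ^ 2 * odd-central k ^ 3)
    (product-identity n t (central n) b E (odd-central k) upper lower even)
  where
  m n t b E : ℕ
  m = suc k
  n = suc m
  t = 2 * m + 1
  b = (2 * n ∸ 2) C m
  E = (2 * n + 2) C (n + 1)
  upper : (n + 1) * E ≡ 2 * (2 * n + 1) * central n
  upper = subst₂ (λ x y → x * y ≡ 2 * (2 * n + 1) * central n)
            (+-comm 1 n) (sym (shifted-central-upper n)) (central-recurrence n)
  lower : n * central n ≡ 2 * t * b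
  lower = subst (λ x → n * central n ≡ 2 * t * x)
            (sym (shifted-central-lower m)) (central-recurrence m)
  even : b ≡ 2 * odd-central k
  even = trans (shifted-central-lower m) (central-even k)
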